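{- Let $n\ge 9$ be an integer, let $C_n: v_1v_2\ldots v_nv_1$ be the cycle of order $n$, and let $G=C_n\bar{C}_n$ be its complementary prism, with vertex set $\{v_1,\ldots,v_n\}\cup\{\bar v_1,\ldots,\bar v_n\}$. Let $k=\lfloor n/9\rfloor$. Let $C\subseteq\{v_1,\ldots,v_n\}$ and $\bar C\subseteq\{\bar v_1,\ldots,\bar v_n\}$ be defined by: $v_i\in C$ if and only if either ($i\bmod 9\in\{1,2,3\}$ and $i\le 9k$) or $i\ge 9k+1$; and $\bar v_i\in\bar C$ if and only if $i\bmod 9\in\{5,6,7,8\}$ and $i\le 9k$. Then $C\cup\bar C$ is an identifying code in $G$. In particular, ${\rm ic}(G)\le \frac{7}{9}n+\frac{16}{9}$.
   Context: The complementary prism $H\bar{H}$ of a graph $H$ with vertices $v_1,\ldots,v_n$ is the disjoint union of $H$ and its complement $\bar H$ (on vertices $\bar v_1,\ldots,\bar v_n$, where $\bar v_i\bar v_j$ is an edge iff $v_iv_j$ is not an edge of $H$) together with the perfect matching $v_1\bar v_1,\ldots,v_n\bar v_n$. A set $D$ of vertices of a graph $G$ is an identifying code if the sets $N_G[u]\cap D$ (where $N_G[u]$ is the closed neighborhood of $u$) are non-empty and pairwise distinct over all vertices $u$ of $G$. ${\rm ic}(G)$ denotes the minimum order of an identifying code in $G$. -}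

module Defs where

open import Data.Nat using (ℕ; zero; suc; _+_; _*_; _≤_; _≤ᵇ_; _/_; _%_; pred)
open import Data.Bool using (Bool; true; false; _∧_; _∨_)
open import Data.Fin using (Fin; toℕ)
open import Data.Fin.Subset using (Subset; _∈_)
open import Data.Vec using (tabulate)
open import Data.Sum using (_⊎_; inj₁; inj₂)
open import Data.Product using (_×_; Σ; ∃; _,_)
open import Relation.Nullary using (¬_)
open import Relation.Binary.PropositionalEquality using (_≡_; _≢_)
open import Function.Bundles using (_⇔_)

Graph : Set → Set₁
Graph V = V → V → Set

_∈N[_]_ : {V : Set} → V → V → Graph V → Set
w ∈N[ u ] G = (w ≡ u) ⊎ G u w

IsIdentifyingCode : {V : Set} → Graph V → (V → Set) → Set
IsIdentifyingCode {V} G D =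
  ((u : V) → ∃ λ w → D w × (w ∈N[ u ] G)) ×
  ((u v : V) → u ≢ v →
     ¬ ((w : V) → ((D w × (w ∈N[ u ] G)) ⇔ (D w × (w ∈N[ v ] G)))))

-- The cycle C_n : v_1 v_2 ... v_n v_1, with v_i represented by (i-1) : Fin n.
-- v_a v_b is an edge iff b ≡ a+1 (mod n) or a ≡ b+1 (mod n).
Cycle : (n : ℕ) → Graph (Fin n)
Cycle n a b = ((toℕ b ≡ (suc (toℕ a)) % suc n') ⊎ (toℕ a ≡ (suc (toℕ b)) % suc n'))
  where
  -- n' = n - 1, so that suc n' = n whenever Fin n is inhabited
  n' : ℕ
  n' = pred n

-- Complementary prism H H̄: vertices inj₁ i = v_i, inj₂ i = v̄_i.
ComplementaryPrism : {n : ℕ} → Graph (Fin n) → Graph (Fin n ⊎ Fin n)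
ComplementaryPrism H (inj₁ i) (inj₁ j) = H i j
ComplementaryPrism H (inj₂ i) (inj₂ j) = (i ≢ j) × ¬ (H i j)
ComplementaryPrism H (inj₁ i) (inj₂ j) = i ≡ j
ComplementaryPrism H (inj₂ i) (inj₁ j) = i ≡ j

codeMember : {n : ℕ} → Subset n × Subset n → Fin n ⊎ Fin n → Set
codeMember (C , C̄) (inj₁ i) = i ∈ C
codeMember (C , C̄) (inj₂ i) = i ∈ C̄

res123 : ℕ → Bool
res123 1 = true
res123 2 = true
res123 3 = true
res123 _ = false

res5678 : ℕ → Bool
res5678 5 = true
res5678 6 = true
res5678 7 = true
res5678 8 = true
res5678 _ = false

-- The paper's sets, with i = toℕ j + 1 the 1-based index and k = ⌊n/9⌋.
-- v_i ∈ C  iff  (i mod 9 ∈ {1,2,3} and i ≤ 9k) or i ≥ 9k+1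
codeC : (n : ℕ) → Subset n
codeC n = tabulate λ j →
  let i = suc (toℕ j) ; k = n / 9 in
  (res123 (i % 9) ∧ (i ≤ᵇ 9 * k)) ∨ (suc (9 * k) ≤ᵇ i)

codeC̄ : (n : ℕ) → Subset n
codeC̄ n = tabulate λ j →
  let i = suc (toℕ j) ; k = n / 9 in
  res5678 (i % 9) ∧ (i ≤ᵇ 9 * k)

module Submission where

-- Identification in Cₙ C̄ₙ is a local question. Four code vertices of C̄ₙ suffice to dominate each v̄ₐ and
-- to tell it apart from every v_b, and two vertices on the same side can only be confused when their
-- indices are adjacent or share a neighbour on the cycle. Each case is settled by a condition on a
-- window of at most five consecutive positions. The paper's code is 9-periodic up to a constant tail,
-- so every window condition is a finite check on residues. Counting 3 + 4 code vertices per period and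
-- at most r ≤ 8 in the tail, with n = 9k + r, gives 9 |C ∪ C̄| ≤ 9 (3k + r + 4k) = 7n + 2r ≤ 7n + 16.

open import Data.Bool using (Bool; true; false; if_then_else_; T; _∧_; _∨_)
open import Data.Bool.Properties using (T-≡; ¬-not; ∧-identityʳ; ∨-identityʳ; ∧-zeroʳ; ∨-zeroʳ)
open import Data.Empty using (⊥; ⊥-elim)
open import Data.Fin using (Fin; zero; suc; toℕ; fromℕ<; _≟_)
open import Data.Fin.Properties using (toℕ-fromℕ<; toℕ-injective; toℕ<n; any?; all?; ¬∀⟶∃¬; pigeonhole)
import Data.Fin.Properties as Fin
open import Data.Fin.Subset using (Subset; _∈_; _∉_; ∣_∣)
open import Data.Fin.Subset.Properties using (_∈?_)
open import Data.Nat using (ℕ; zero; suc; _+_; _*_; _≤_; _<_; _≤ᵇ_; _≡ᵇ_; _≤?_; _/_; _%_; z≤n; s≤s; NonZero; _<?_)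
open import Data.Nat.DivMod
open import Data.Nat.Properties
  using ( +-comm; +-assoc; +-suc; +-identityʳ; +-cancelˡ-≡; +-cancelʳ-≡; *-comm; n≤1+n; m≤m+n
        ; ≤-refl; ≤-reflexive; ≤-trans; ≤-antisym; ≤-pred; <-≤-trans; <⇒≱; <⇒≢; ≰⇒>; ≤∧≢⇒<; <-cmp
        ; +-mono-≤; +-monoʳ-≤; +-monoʳ-<; +-monoˡ-<; *-monoʳ-≤; *-monoˡ-≤; ≤⇒≤ᵇ; ≤ᵇ⇒≤; ≡ᵇ⇒≡
        ; module ≤-Reasoning)
  renaming (_≟_ to _≟ℕ_)
open import Data.Nat.Tactic.RingSolver using (solve-∀)
open import Data.Product using (_×_; _,_; ∃; proj₁; proj₂)
open import Data.Sum using (_⊎_; inj₁; inj₂)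
import Data.Sum as Sum
open import Data.Vec using (tabulate)
open import Data.Vec.Properties using (lookup∘tabulate; []=⇒lookup; lookup⇒[]=)
open import Function using (_∘_; flip)
open import Function.Bundles using (Equivalence)
open import Function.Definitions using (Injective)
open import Relation.Binary using (tri<; tri≈; tri>; DecidableEquality)
open import Relation.Binary.PropositionalEquality
open import Relation.Nullary using (¬_; Dec; yes; no; contradiction)

open import Defs

-- If every value of c hit some value of e, the pigeonhole principle would contradict injectivity.
avoid : ∀ {A : Set} {k} → DecidableEquality A → (c : Fin (suc k) → A) → Injective _≡_ _≡_ c →
        (e : Fin k → A) → ∃ λ i → ∀ j → c i ≢ e j
avoid {k = k} _≟ᴬ_ c c-injective e with all? (λ i → any? (λ j → c i ≟ᴬ e j))
... | yes hit =
  let i , i′ , i<i′ , fi≡fi′ = pigeonhole ≤-refl (proj₁ ∘ hit)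
  in ⊥-elim (Fin.<⇒≢ i<i′ (c-injective (trans (proj₂ (hit i)) (trans (cong e fi≡fi′) (sym (proj₂ (hit i′)))))))
... | no ¬hit with ¬∀⟶∃¬ _ _ (λ i → any? (λ j → c i ≟ᴬ e j)) ¬hit
...   | i , miss = i , λ j ci≡ej → miss (j , ci≡ej)

∈-tabulate⁺ : ∀ {n} (f : Fin n → Bool) {a} → f a ≡ true → a ∈ tabulate f
∈-tabulate⁺ f {a} fa≡true = lookup⇒[]= a (tabulate f) (trans (lookup∘tabulate f a) fa≡true)

∈-tabulate⁻ : ∀ {n} (f : Fin n → Bool) {a} → a ∈ tabulate f → f a ≡ true
∈-tabulate⁻ f {a} a∈f = trans (sym (lookup∘tabulate f a)) ([]=⇒lookup a∈f)

T⇒≡true : ∀ {b} → T b → b ≡ true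
T⇒≡true = Equivalence.to T-≡

¬T⇒≡false : ∀ {b} → ¬ T b → b ≡ false
¬T⇒≡false ¬Tb = ¬-not (¬Tb ∘ Equivalence.from T-≡)

countBelow : (ℕ → Bool) → ℕ → ℕ
countBelow g zero    = 0
countBelow g (suc n) = (if g 0 then 1 else 0) + countBelow (g ∘ suc) n

∣tabulate∣≡countBelow : ∀ n (g : ℕ → Bool) → ∣ tabulate {n = n} (g ∘ toℕ) ∣ ≡ countBelow g n
∣tabulate∣≡countBelow zero    g = refl
∣tabulate∣≡countBelow (suc n) g with g 0
... | true  = cong suc (∣tabulate∣≡countBelow n (g ∘ suc))
... | false = ∣tabulate∣≡countBelow n (g ∘ suc)

countBelow-+ : ∀ a b g → countBelow g (a + b) ≡ countBelow g a + countBelow (λ x → g (a + x)) b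
countBelow-+ zero    b g = refl
countBelow-+ (suc a) b g =
  trans (cong (_ +_) (countBelow-+ a b (g ∘ suc))) (sym (+-assoc (if g 0 then 1 else 0) _ _))

countBelow-≤ : ∀ n g → countBelow g n ≤ n
countBelow-≤ zero    g = z≤n
countBelow-≤ (suc n) g with g 0
... | true  = s≤s (countBelow-≤ n (g ∘ suc))
... | false = ≤-trans (countBelow-≤ n (g ∘ suc)) (n≤1+n n)

countBelow-cong : ∀ n {g h} → (∀ x → x < n → g x ≡ h x) → countBelow g n ≡ countBelow h n
countBelow-cong zero    g≗h = refl
countBelow-cong (suc n) g≗h =
  cong₂ _+_ (cong (λ b → if b then 1 else 0) (g≗h 0 (s≤s z≤n))) (countBelow-cong n (λ x x<n → g≗h (suc x) (s≤s x<n)))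

countBelow-none : ∀ n {g} → (∀ x → x < n → g x ≡ false) → countBelow g n ≡ 0
countBelow-none zero    _   = refl
countBelow-none (suc n) {g} none with g 0 | none 0 (s≤s z≤n)
... | false | _ = countBelow-none n (λ x x<n → none (suc x) (s≤s x<n))

countBelow-blocks : ∀ p j g c → (∀ q → q < j → countBelow (λ x → g (q * p + x)) p ≤ c) →
                    countBelow g (j * p) ≤ j * c
countBelow-blocks p zero    g c _     = z≤n
countBelow-blocks p (suc j) g c block = begin
  countBelow g (p + j * p)                                   ≡⟨ countBelow-+ p (j * p) g ⟩
  countBelow g p + countBelow (λ x → g (p + x)) (j * p)      ≤⟨ +-mono-≤ (block 0 (s≤s z≤n)) rest ⟩
  c + j * c                                                  ∎
  where
  open ≤-Reasoning
  rest : countBelow (λ x → g (p + x)) (j * p) ≤ j * c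
  rest = countBelow-blocks p j (λ x → g (p + x)) c λ q q<j →
    ≤-trans (≤-reflexive (countBelow-cong p λ x _ → cong g (sym (+-assoc p (q * p) x)))) (block (suc q) (s≤s q<j))

[m+n%d]%d≡[m+n]%d : ∀ m n d .{{_ : NonZero d}} → (m + n % d) % d ≡ (m + n) % d
[m+n%d]%d≡[m+n]%d m n d = begin
  (m + n % d) % d            ≡⟨ %-distribˡ-+ m (n % d) d ⟩
  (m % d + n % d % d) % d    ≡⟨ cong (λ t → (m % d + t) % d) (m%n%n≡m%n n d) ⟩
  (m % d + n % d) % d        ≡⟨ %-distribˡ-+ m n d ⟨
  (m + n) % d                ∎
  where open ≡-Reasoning

module Rotation (m : ℕ) where

  N : ℕ
  N = suc m

  next : Fin N → Fin N
  next a = fromℕ< (m%n<n (1 + toℕ a) N)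

  prev : Fin N → Fin N
  prev a = fromℕ< (m%n<n (m + toℕ a) N)

  toℕ-next : ∀ a → toℕ (next a) ≡ (1 + toℕ a) % N
  toℕ-next a = toℕ-fromℕ< _

  toℕ-prev : ∀ a → toℕ (prev a) ≡ (m + toℕ a) % N
  toℕ-prev a = toℕ-fromℕ< _

  [N+x]%N≡x : ∀ (a : Fin N) → (N + toℕ a) % N ≡ toℕ a
  [N+x]%N≡x a = begin
    (N + toℕ a) % N ≡⟨ cong (_% N) (+-comm N (toℕ a)) ⟩
    (toℕ a + N) % N ≡⟨ [m+n]%n≡m%n (toℕ a) N ⟩
    toℕ a % N       ≡⟨ m<n⇒m%n≡m (toℕ<n a) ⟩
    toℕ a           ∎
    where open ≡-Reasoning

  next-prev : ∀ a → next (prev a) ≡ a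
  next-prev a = toℕ-injective (begin
    toℕ (next (prev a))       ≡⟨ toℕ-next (prev a) ⟩
    (1 + toℕ (prev a)) % N    ≡⟨ cong (λ t → (1 + t) % N) (toℕ-prev a) ⟩
    (1 + (m + toℕ a) % N) % N ≡⟨ [m+n%d]%d≡[m+n]%d 1 (m + toℕ a) N ⟩
    (N + toℕ a) % N           ≡⟨ [N+x]%N≡x a ⟩
    toℕ a                     ∎)
    where open ≡-Reasoning

  prev-next : ∀ a → prev (next a) ≡ a
  prev-next a = toℕ-injective (begin
    toℕ (prev (next a))       ≡⟨ toℕ-prev (next a) ⟩
    (m + toℕ (next a)) % N    ≡⟨ cong (λ t → (m + t) % N) (toℕ-next a) ⟩
    (m + (1 + toℕ a) % N) % N ≡⟨ [m+n%d]%d≡[m+n]%d m (1 + toℕ a) N ⟩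
    (m + (1 + toℕ a)) % N     ≡⟨ cong (_% N) (+-suc m (toℕ a)) ⟩
    (N + toℕ a) % N           ≡⟨ [N+x]%N≡x a ⟩
    toℕ a                     ∎)
    where open ≡-Reasoning

  next-injective : ∀ {a b} → next a ≡ next b → a ≡ b
  next-injective {a} {b} e = begin
    a               ≡⟨ prev-next a ⟨
    prev (next a)   ≡⟨ cong prev e ⟩
    prev (next b)   ≡⟨ prev-next b ⟩
    b               ∎
    where open ≡-Reasoning

  next^ : ℕ → Fin N → Fin N
  next^ zero    a = a
  next^ (suc d) a = next (next^ d a)

  toℕ-next^ : ∀ d a → toℕ (next^ d a) ≡ (d + toℕ a) % N
  toℕ-next^ zero    a = sym (m<n⇒m%n≡m (toℕ<n a))
  toℕ-next^ (suc d) a = begin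
    toℕ (next (next^ d a))    ≡⟨ toℕ-next (next^ d a) ⟩
    (1 + toℕ (next^ d a)) % N ≡⟨ cong (λ t → (1 + t) % N) (toℕ-next^ d a) ⟩
    (1 + (d + toℕ a) % N) % N ≡⟨ [m+n%d]%d≡[m+n]%d 1 (d + toℕ a) N ⟩
    (suc d + toℕ a) % N       ∎
    where open ≡-Reasoning

  -- Going round a proper arc returns to a only if its length is a multiple of N.
  next^-≢ : ∀ d a → suc d < N → next^ (suc d) a ≢ a
  next^-≢ d a d<N e = multiple-of-N q (+-cancelʳ-≡ x (suc d) (q * N) shift)
    where
    x q : ℕ
    x = toℕ a
    q = (suc d + x) / N
    shift : suc d + x ≡ q * N + x
    shift = begin
      suc d + x               ≡⟨ m≡m%n+[m/n]*n (suc d + x) N ⟩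
      (suc d + x) % N + q * N ≡⟨ cong (_+ q * N) (trans (sym (toℕ-next^ (suc d) a)) (cong toℕ e)) ⟩
      x + q * N               ≡⟨ +-comm x (q * N) ⟩
      q * N + x               ∎
      where open ≡-Reasoning
    multiple-of-N : ∀ r → suc d ≡ r * N → ⊥
    multiple-of-N zero    ()
    multiple-of-N (suc r) e′ = <⇒≱ d<N (subst (N ≤_) (sym e′) (m≤m+n N (r * N)))

  all-next⇒all : {P : Fin N → Set} → (∀ c → P (next c)) → ∀ a → P a
  all-next⇒all {P} h a = subst P (next-prev a) (h (prev a))

  Adjacent : Fin N → Fin N → Set
  Adjacent a b = b ≡ next a ⊎ a ≡ next b

  Adjacent-sym : ∀ {a b} → Adjacent a b → Adjacent b a
  Adjacent-sym = Sum.swap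

  adjacent? : ∀ a b → Dec (Adjacent a b)
  adjacent? a b with b ≟ next a | a ≟ next b
  ... | yes e | _     = yes (inj₁ e)
  ... | no _  | yes e = yes (inj₂ e)
  ... | no ¬e | no ¬e′ = no λ { (inj₁ e) → ¬e e ; (inj₂ e) → ¬e′ e }

  ¬Adjacent : ∀ {a y} → y ≢ next a → y ≢ prev a → ¬ Adjacent a y
  ¬Adjacent y≢a⁺ _    (inj₁ e) = y≢a⁺ e
  ¬Adjacent {a} {y} _ y≢a⁻ (inj₂ e) = y≢a⁻ (trans (sym (prev-next y)) (cong prev (sym e)))

  Cycle⇒Adjacent : ∀ {a b} → Cycle N a b → Adjacent a b
  Cycle⇒Adjacent {a} {b} (inj₁ e) = inj₁ (toℕ-injective (trans e (sym (toℕ-next a))))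
  Cycle⇒Adjacent {a} {b} (inj₂ e) = inj₂ (toℕ-injective (trans e (sym (toℕ-next b))))

  Adjacent⇒Cycle : ∀ {a b} → Adjacent a b → Cycle N a b
  Adjacent⇒Cycle {a} {b} (inj₁ e) = inj₁ (trans (cong toℕ e) (toℕ-next a))
  Adjacent⇒Cycle {a} {b} (inj₂ e) = inj₂ (trans (cong toℕ e) (toℕ-next b))

  -- Conditions on windows c, c+1, … of the cycle under which C ∪ C̄ identifies Cₙ C̄ₙ (for n ≥ 5).
  record CodeConditions (C C̄ : Subset N) : Set where
    field
      C-dominates       : ∀ c → next c ∉ C → next c ∉ C̄ → c ∈ C ⊎ next^ 2 c ∈ C
      C-not-isolated    : ∀ c → next c ∈ C → c ∈ C ⊎ next^ 2 c ∈ C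
      C̄-dominates       : ∀ c → next c ∉ C → c ∈ C̄ ⊎ next^ 2 c ∈ C̄
      C̄-distance-two    : ∀ c → next^ 2 c ∈ C̄ → c ∈ C̄ ⊎ next^ 4 c ∈ C̄
      separates-edges   : ∀ c → c ∈ C ⊎ next^ 3 c ∈ C ⊎ next c ∈ C̄ ⊎ next^ 2 c ∈ C̄
      C̄-witness         : Fin 4 → Fin N
      C̄-witness-injective : Injective _≡_ _≡_ C̄-witness
      C̄-witness-∈       : ∀ i → C̄-witness i ∈ C̄

module Criterion (m : ℕ) (4≤m : 4 ≤ m) where
  open Rotation m

  short : ∀ {d} → d < 4 → suc d < N
  short d<4 = s≤s (≤-trans d<4 4≤m)

  next≢ : ∀ a → next a ≢ a
  next≢ a = next^-≢ 0 a (short (s≤s z≤n))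

  next²≢ : ∀ a → next^ 2 a ≢ a
  next²≢ a = next^-≢ 1 a (short (s≤s (s≤s z≤n)))

  next³≢ : ∀ a → next^ 3 a ≢ a
  next³≢ a = next^-≢ 2 a (short (s≤s (s≤s (s≤s z≤n))))

  next⁴≢ : ∀ a → next^ 4 a ≢ a
  next⁴≢ a = next^-≢ 3 a (short ≤-refl)

  ¬Adjacent-refl : ∀ a → ¬ Adjacent a a
  ¬Adjacent-refl a (inj₁ e) = next≢ a (sym e)
  ¬Adjacent-refl a (inj₂ e) = next≢ a (sym e)

  common-neighbour : ∀ {a b c} → a ≢ b → Adjacent a c → Adjacent b c →
                     (c ≡ next a × b ≡ next c) ⊎ (c ≡ next b × a ≡ next c)
  common-neighbour a≢b (inj₁ c≡a⁺) (inj₁ c≡b⁺) = ⊥-elim (a≢b (next-injective (trans (sym c≡a⁺) c≡b⁺)))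
  common-neighbour _   (inj₁ c≡a⁺) (inj₂ b≡c⁺) = inj₁ (c≡a⁺ , b≡c⁺)
  common-neighbour _   (inj₂ a≡c⁺) (inj₁ c≡b⁺) = inj₂ (c≡b⁺ , a≡c⁺)
  common-neighbour a≢b (inj₂ a≡c⁺) (inj₂ b≡c⁺) = ⊥-elim (a≢b (trans a≡c⁺ (sym b≡c⁺)))

  Vertex : Set
  Vertex = Fin N ⊎ Fin N

  G : Graph Vertex
  G = ComplementaryPrism (Cycle N)

  v∈N[v]⁺ : ∀ {a y} → y ≡ a ⊎ Adjacent a y → inj₁ y ∈N[ inj₁ a ] G
  v∈N[v]⁺ (inj₁ refl) = inj₁ refl
  v∈N[v]⁺ (inj₂ adj)  = inj₂ (Adjacent⇒Cycle adj)

  v∈N[v]⁻ : ∀ {a y} → inj₁ y ∈N[ inj₁ a ] G → y ≡ a ⊎ Adjacent a y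
  v∈N[v]⁻ (inj₁ refl) = inj₁ refl
  v∈N[v]⁻ (inj₂ c)    = inj₂ (Cycle⇒Adjacent c)

  v̄∈N[v]⁻ : ∀ {a y} → inj₂ y ∈N[ inj₁ a ] G → a ≡ y
  v̄∈N[v]⁻ (inj₂ a≡y) = a≡y

  v∈N[v̄]⁻ : ∀ {a y} → inj₁ y ∈N[ inj₂ a ] G → a ≡ y
  v∈N[v̄]⁻ (inj₂ a≡y) = a≡y

  v̄∈N[v̄]⁺ : ∀ {a y} → ¬ Adjacent a y → inj₂ y ∈N[ inj₂ a ] G
  v̄∈N[v̄]⁺ {a} {y} ¬adj with y ≟ a
  ... | yes y≡a = inj₁ (cong inj₂ y≡a)
  ... | no y≢a  = inj₂ ((λ a≡y → y≢a (sym a≡y)) , λ c → ¬adj (Cycle⇒Adjacent c))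

  v̄∈N[v̄]⁻ : ∀ {a y} → inj₂ y ∈N[ inj₂ a ] G → ¬ Adjacent a y
  v̄∈N[v̄]⁻ (inj₁ refl)      = ¬Adjacent-refl _
  v̄∈N[v̄]⁻ (inj₂ (_ , ¬c)) adj = ¬c (Adjacent⇒Cycle adj)

  module _ {C C̄ : Subset N} (conditions : CodeConditions C C̄) where
    open CodeConditions conditions

    D : Vertex → Set
    D = codeMember (C , C̄)

    _⊑_ : Vertex → Vertex → Set
    u ⊑ v = ∀ w → D w → w ∈N[ u ] G → w ∈N[ v ] G

    escapes : ∀ {u v} w → D w → w ∈N[ u ] G → ¬ (w ∈N[ v ] G) → ¬ (u ⊑ v)
    escapes w w∈D w∈N[u] w∉N[v] u⊑v = w∉N[v] (u⊑v w w∈D w∈N[u])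

    neighbour-in : ∀ {P : Fin N → Set} c → P c ⊎ P (next^ 2 c) → ∃ λ d → Adjacent (next c) d × P d
    neighbour-in c (inj₁ Pc)  = c , inj₂ refl , Pc
    neighbour-in c (inj₂ Pc²) = next^ 2 c , inj₁ refl , Pc²

    C-neighbour : ∀ a → a ∉ C → a ∉ C̄ → ∃ λ d → Adjacent a d × d ∈ C
    C-neighbour = all-next⇒all λ c c¹∉C c¹∉C̄ → neighbour-in c (C-dominates c c¹∉C c¹∉C̄)

    C̄-neighbour : ∀ a → a ∉ C → ∃ λ d → Adjacent a d × d ∈ C̄
    C̄-neighbour = all-next⇒all λ c c¹∉C → neighbour-in c (C̄-dominates c c¹∉C)

    avoiding : ∀ e₁ e₂ e₃ → ∃ λ j → j ∈ C̄ × j ≢ e₁ × j ≢ e₂ × j ≢ e₃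
    avoiding e₁ e₂ e₃ with avoid _≟_ C̄-witness C̄-witness-injective
                                   (λ { zero → e₁ ; (suc zero) → e₂ ; (suc (suc zero)) → e₃ })
    ... | i , miss = C̄-witness i , C̄-witness-∈ i , miss zero , miss (suc zero) , miss (suc (suc zero))

    dominating : ∀ u → ∃ λ w → D w × w ∈N[ u ] G
    dominating (inj₁ a) with a ∈? C | a ∈? C̄
    ... | yes a∈C | _      = inj₁ a , a∈C , inj₁ refl
    ... | no _    | yes a∈C̄ = inj₂ a , a∈C̄ , inj₂ refl
    ... | no a∉C  | no a∉C̄ with C-neighbour a a∉C a∉C̄
    ...   | d , adj , d∈C = inj₁ d , d∈C , v∈N[v]⁺ (inj₂ adj)
    dominating (inj₂ a) with avoiding (next a) (prev a) a
    ... | j , j∈C̄ , j≢a⁺ , j≢a⁻ , _ = inj₂ j , j∈C̄ , v̄∈N[v̄]⁺ (¬Adjacent j≢a⁺ j≢a⁻)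

    separate-v-v̄ : ∀ a b → ¬ (inj₂ b ⊑ inj₁ a)
    separate-v-v̄ a b with avoiding a (next b) (prev b)
    ... | j , j∈C̄ , j≢a , j≢b⁺ , j≢b⁻ =
      escapes (inj₂ j) j∈C̄ (v̄∈N[v̄]⁺ (¬Adjacent j≢b⁺ j≢b⁻)) (λ j∈N[a] → j≢a (sym (v̄∈N[v]⁻ j∈N[a])))

    -- N[v_{c+1}] and N[v_{c+2}] differ exactly in v_c, v_{c+3}, v̄_{c+1}, v̄_{c+2}.
    separate-edge : ∀ c → inj₁ (next c) ⊑ inj₁ (next^ 2 c) → ¬ (inj₁ (next^ 2 c) ⊑ inj₁ (next c))
    separate-edge c ⊑ with separates-edges c
    ... | inj₁ c∈C = ⊥-elim (escapes (inj₁ c) c∈C (v∈N[v]⁺ (inj₂ (inj₂ refl))) c∉N[c²] ⊑)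
      where
      c∉N[c²] : ¬ inj₁ c ∈N[ inj₁ (next^ 2 c) ] G
      c∉N[c²] w with v∈N[v]⁻ w
      ... | inj₁ e        = next²≢ c (sym e)
      ... | inj₂ (inj₁ e) = next³≢ c (sym e)
      ... | inj₂ (inj₂ e) = next≢ (next c) e
    ... | inj₂ (inj₁ c³∈C) = escapes (inj₁ (next^ 3 c)) c³∈C (v∈N[v]⁺ (inj₂ (inj₁ refl))) c³∉N[c¹]
      where
      c³∉N[c¹] : ¬ inj₁ (next^ 3 c) ∈N[ inj₁ (next c) ] G
      c³∉N[c¹] w with v∈N[v]⁻ w
      ... | inj₁ e        = next²≢ (next c) e
      ... | inj₂ (inj₁ e) = next≢ (next^ 2 c) e
      ... | inj₂ (inj₂ e) = next³≢ (next c) (sym e)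
    ... | inj₂ (inj₂ (inj₁ c¹∈C̄)) =
      ⊥-elim (escapes (inj₂ (next c)) c¹∈C̄ (inj₂ refl) (λ w → next≢ (next c) (v̄∈N[v]⁻ w)) ⊑)
    ... | inj₂ (inj₂ (inj₂ c²∈C̄)) =
      escapes (inj₂ (next^ 2 c)) c²∈C̄ (inj₂ refl) (λ w → next≢ (next c) (sym (v̄∈N[v]⁻ w)))

    separate-adjacent : ∀ a → inj₁ a ⊑ inj₁ (next a) → ¬ (inj₁ (next a) ⊑ inj₁ a)
    separate-adjacent = all-next⇒all separate-edge

    C-member-adjacent : ∀ {a b} → a ∈ C → inj₁ a ⊑ inj₁ b → a ≡ b ⊎ Adjacent a b
    C-member-adjacent a∈C a⊑b = Sum.map₂ Adjacent-sym (v∈N[v]⁻ (a⊑b (inj₁ _) a∈C (inj₁ refl)))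

    C̄-member-equal : ∀ {a b} → a ∈ C̄ → inj₁ a ⊑ inj₁ b → b ≡ a
    C̄-member-equal a∈C̄ a⊑b = v̄∈N[v]⁻ (a⊑b (inj₂ _) a∈C̄ (inj₂ refl))

    -- A common code neighbour of non-adjacent vₐ, v_b is the midpoint of a path vₐ v v_b, and
    -- then C-not-isolated puts vₐ or v_b itself into C.
    separate-v-v : ∀ {a b} → a ≢ b → ¬ Adjacent a b → inj₁ a ⊑ inj₁ b → ¬ (inj₁ b ⊑ inj₁ a)
    separate-v-v {a} {b} a≢b ¬adj a⊑b b⊑a with a ∈? C | b ∈? C | a ∈? C̄ | b ∈? C̄
    ... | yes a∈C | _ | _ | _ = Sum.[ a≢b , ¬adj ] (C-member-adjacent a∈C a⊑b)
    ... | no _ | yes b∈C | _ | _ = Sum.[ a≢b ∘ sym , ¬adj ∘ Adjacent-sym ] (C-member-adjacent b∈C b⊑a)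
    ... | no _ | no _ | yes a∈C̄ | _ = a≢b (sym (C̄-member-equal a∈C̄ a⊑b))
    ... | no _ | no _ | no _ | yes b∈C̄ = a≢b (C̄-member-equal b∈C̄ b⊑a)
    ... | no a∉C | no b∉C | no a∉C̄ | no _ with C-neighbour a a∉C a∉C̄
    ...   | d , a~d , d∈C with v∈N[v]⁻ (a⊑b (inj₁ d) d∈C (v∈N[v]⁺ (inj₂ a~d)))
    ...     | inj₁ refl = b∉C d∈C
    ...     | inj₂ b~d with common-neighbour a≢b a~d b~d
    ...       | inj₁ (refl , refl) = Sum.[ a∉C , b∉C ] (C-not-isolated a d∈C)
    ...       | inj₂ (refl , refl) = Sum.[ b∉C , a∉C ] (C-not-isolated b d∈C)

    -- On the complement side, N[v̄ₓ] and N[v̄ₓ₊₂] differ exactly in v̄ₓ₋₁ and v̄ₓ₊₃.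
    separate-v̄-distance-two : ∀ x → next x ∈ C̄ → inj₂ x ⊑ inj₂ (next^ 2 x) → ¬ (inj₂ (next^ 2 x) ⊑ inj₂ x)
    separate-v̄-distance-two = all-next⇒all separate
      where
      separate : ∀ c → next^ 2 c ∈ C̄ → inj₂ (next c) ⊑ inj₂ (next^ 3 c) → ¬ (inj₂ (next^ 3 c) ⊑ inj₂ (next c))
      separate c c²∈C̄ ⊑ ⊒ with C̄-distance-two c c²∈C̄
      ... | inj₁ c∈C̄ = escapes (inj₂ c) c∈C̄ (v̄∈N[v̄]⁺ ¬c³~c) (λ w → v̄∈N[v̄]⁻ w (inj₂ refl)) ⊒
        where
        ¬c³~c : ¬ Adjacent (next^ 3 c) c
        ¬c³~c (inj₁ e) = next⁴≢ c (sym e)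
        ¬c³~c (inj₂ e) = next²≢ (next c) e
      ... | inj₂ c⁴∈C̄ = escapes (inj₂ (next^ 4 c)) c⁴∈C̄ (v̄∈N[v̄]⁺ ¬c¹~c⁴) (λ w → v̄∈N[v̄]⁻ w (inj₁ refl)) ⊑
        where
        ¬c¹~c⁴ : ¬ Adjacent (next c) (next^ 4 c)
        ¬c¹~c⁴ (inj₁ e) = next²≢ (next^ 2 c) e
        ¬c¹~c⁴ (inj₂ e) = next⁴≢ (next c) (sym e)

    -- For a cycle-neighbour d ∈ C̄ of a, v̄_d ∉ N[v̄ₐ]; so v̄_d ∉ N[v̄_b], i.e. d is a cycle-neighbour of b too.
    separate-v̄-v̄ : ∀ {a b} → a ≢ b → inj₂ a ⊑ inj₂ b → ¬ (inj₂ b ⊑ inj₂ a)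
    separate-v̄-v̄ {a} {b} a≢b a⊑b b⊑a with a ∈? C | b ∈? C
    ... | yes a∈C | _ = a≢b (sym (v∈N[v̄]⁻ (a⊑b (inj₁ a) a∈C (inj₂ refl))))
    ... | no _ | yes b∈C = a≢b (v∈N[v̄]⁻ (b⊑a (inj₁ b) b∈C (inj₂ refl)))
    ... | no a∉C | no _ with C̄-neighbour a a∉C
    ...   | d , a~d , d∈C̄ with adjacent? b d
    ...     | no ¬b~d = escapes (inj₂ d) d∈C̄ (v̄∈N[v̄]⁺ ¬b~d) (λ w → v̄∈N[v̄]⁻ w a~d) b⊑a
    ...     | yes b~d with common-neighbour a≢b a~d b~d
    ...       | inj₁ (refl , refl) = separate-v̄-distance-two a d∈C̄ a⊑b b⊑a
    ...       | inj₂ (refl , refl) = separate-v̄-distance-two b d∈C̄ b⊑a a⊑b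

    distinguishes : ∀ u v → u ≢ v → u ⊑ v → ¬ (v ⊑ u)
    distinguishes (inj₁ a) (inj₁ b) u≢v with adjacent? a b
    ... | yes (inj₁ refl) = separate-adjacent a
    ... | yes (inj₂ refl) = flip (separate-adjacent b)
    ... | no ¬adj         = separate-v-v (u≢v ∘ cong inj₁) ¬adj
    distinguishes (inj₂ a) (inj₂ b) u≢v = separate-v̄-v̄ (u≢v ∘ cong inj₂)
    distinguishes (inj₁ a) (inj₂ b) _ _ = separate-v-v̄ a b
    distinguishes (inj₂ a) (inj₁ b) _ a⊑b _ = separate-v-v̄ b a a⊑b

    identifying : IsIdentifyingCode G D
    identifying = dominating , λ u v u≢v same →
      distinguishes u v u≢v (λ w w∈D w∈N[u] → proj₂ (Equivalence.to (same w) (w∈D , w∈N[u])))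
                            (λ w w∈D w∈N[v] → proj₂ (Equivalence.from (same w) (w∈D , w∈N[v])))

module PaperCode (m : ℕ) (8≤m : 8 ≤ m) where
  open Rotation m

  K : ℕ
  K = 9 * (N / 9)

  K≤N : K ≤ N
  K≤N = subst (_≤ N) (*-comm (N / 9) 9) (m/n*n≤m N 9)

  9≤K : 9 ≤ K
  9≤K = *-monoʳ-≤ 9 (m≥n⇒m/n>0 {N} {9} (s≤s 8≤m))

  K%9≡0 : K % 9 ≡ 0
  K%9≡0 = trans (cong (_% 9) (*-comm 9 (N / 9))) (m*n%n≡0 (N / 9) 9)

  -- The paper's vertex v_{x+1} is labelled (x+1) mod 9 when x+1 ≤ 9k and 9 when x+1 > 9k;
  -- membership in either half of the code only depends on this label.
  lab : ℕ → ℕ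
  lab x with x <? K
  ... | yes _ = suc x % 9
  ... | no _  = 9

  lab-< : ∀ {x} → x < K → lab x ≡ suc x % 9
  lab-< {x} x<K with x <? K
  ... | yes _   = refl
  ... | no x≮K = contradiction x<K x≮K

  lab-≥ : ∀ {x} → K ≤ x → lab x ≡ 9
  lab-≥ {x} K≤x with x <? K
  ... | yes x<K = contradiction K≤x (<⇒≱ x<K)
  ... | no _    = refl

  -- Consecutive labels around the cycle: k periods 1 2 … 8 0, then a (possibly empty) tail 9 … 9.
  data Step : ℕ → ℕ → Set where
    1→2 : Step 1 2
    2→3 : Step 2 3
    3→4 : Step 3 4
    4→5 : Step 4 5
    5→6 : Step 5 6
    6→7 : Step 6 7
    7→8 : Step 7 8
    8→0 : Step 8 0
    0→1 : Step 0 1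
    0→9 : Step 0 9
    9→9 : Step 9 9
    9→1 : Step 9 1

  step-mod9 : ∀ t → t < 9 → Step t (suc t % 9)
  step-mod9 0 _ = 0→1
  step-mod9 1 _ = 1→2
  step-mod9 2 _ = 2→3
  step-mod9 3 _ = 3→4
  step-mod9 4 _ = 4→5
  step-mod9 5 _ = 5→6
  step-mod9 6 _ = 6→7
  step-mod9 7 _ = 7→8
  step-mod9 8 _ = 8→0
  step-mod9 (suc (suc (suc (suc (suc (suc (suc (suc (suc _))))))))) (s≤s (s≤s (s≤s (s≤s (s≤s (s≤s (s≤s (s≤s (s≤s ())))))))))

  lab-step : ∀ x → Step (lab x) (lab (suc x))
  lab-step x with <-cmp (suc x) K
  ... | tri< x⁺<K _ _ = subst₂ Step (sym (lab-< (≤-trans (n≤1+n (suc x)) x⁺<K))) (sym lab-x⁺)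
                                    (step-mod9 (suc x % 9) (m%n<n (suc x) 9))
    where
    lab-x⁺ : lab (suc x) ≡ suc (suc x % 9) % 9
    lab-x⁺ = trans (lab-< x⁺<K) (sym ([m+n%d]%d≡[m+n]%d 1 (suc x) 9))
  ... | tri≈ _ x⁺≡K _ = subst₂ Step (sym lab-x) (sym (lab-≥ (≤-reflexive (sym x⁺≡K)))) 0→9
    where
    lab-x : lab x ≡ 0
    lab-x = trans (lab-< (≤-reflexive x⁺≡K)) (trans (cong (_% 9) x⁺≡K) K%9≡0)
  ... | tri> _ _ K<x⁺ = subst₂ Step (sym (lab-≥ (≤-pred K<x⁺))) (sym (lab-≥ (≤-trans (n≤1+n K) K<x⁺))) 9→9

  lab-0 : lab 0 ≡ 1
  lab-0 = lab-< (≤-trans (s≤s z≤n) 9≤K)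

  lab-wrap : Step (lab m) (lab 0)
  lab-wrap with K ≤? m
  ... | yes K≤m = subst₂ Step (sym (lab-≥ K≤m)) (sym lab-0) 9→1
  ... | no K≰m  = subst₂ Step (sym (trans (lab-< m<K) (trans (cong (_% 9) (≤-antisym m<K K≤N)) K%9≡0))) (sym lab-0) 0→1
    where
    m<K : m < K
    m<K = ≰⇒> K≰m

  label : Fin N → ℕ
  label a = lab (toℕ a)

  label-step : ∀ a → Step (label a) (label (next a))
  label-step a with toℕ a ≟ℕ m
  ... | yes a≡m = subst₂ Step (cong lab (sym a≡m)) (cong lab (sym next-a≡0)) lab-wrap
    where
    next-a≡0 : toℕ (next a) ≡ 0
    next-a≡0 = trans (toℕ-next a) (trans (cong (λ t → suc t % N) a≡m) (n%n≡0 N))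
  ... | no a≢m = subst (Step (label a)) (cong lab (sym next-a≡a⁺)) (lab-step (toℕ a))
    where
    next-a≡a⁺ : toℕ (next a) ≡ suc (toℕ a)
    next-a≡a⁺ = trans (toℕ-next a) (m<n⇒m%n≡m (s≤s (≤∧≢⇒< (≤-pred (toℕ<n a)) a≢m)))

  C-label : ℕ → Bool
  C-label l = res123 l ∨ (l ≡ᵇ 9)

  window-C-dominates : ∀ {l₀ l₁ l₂} → Step l₀ l₁ → Step l₁ l₂ → C-label l₁ ≡ false → res5678 l₁ ≡ false →
                       C-label l₀ ≡ true ⊎ C-label l₂ ≡ true
  window-C-dominates 3→4 _   _ _ = inj₁ refl
  window-C-dominates 8→0 0→1 _ _ = inj₂ refl
  window-C-dominates 8→0 0→9 _ _ = inj₂ refl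
  window-C-dominates 1→2 _ () _
  window-C-dominates 2→3 _ () _
  window-C-dominates 4→5 _ _ ()
  window-C-dominates 5→6 _ _ ()
  window-C-dominates 6→7 _ _ ()
  window-C-dominates 7→8 _ _ ()
  window-C-dominates 0→1 _ () _
  window-C-dominates 0→9 _ () _
  window-C-dominates 9→9 _ () _
  window-C-dominates 9→1 _ () _

  window-C-not-isolated : ∀ {l₀ l₁ l₂} → Step l₀ l₁ → Step l₁ l₂ → C-label l₁ ≡ true →
                          C-label l₀ ≡ true ⊎ C-label l₂ ≡ true
  window-C-not-isolated 1→2 _   _ = inj₁ refl
  window-C-not-isolated 2→3 _   _ = inj₁ refl
  window-C-not-isolated 9→9 _   _ = inj₁ refl
  window-C-not-isolated 9→1 _   _ = inj₁ refl
  window-C-not-isolated 0→1 1→2 _ = inj₂ refl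
  window-C-not-isolated 0→9 9→9 _ = inj₂ refl
  window-C-not-isolated 0→9 9→1 _ = inj₂ refl
  window-C-not-isolated 3→4 _ ()
  window-C-not-isolated 4→5 _ ()
  window-C-not-isolated 5→6 _ ()
  window-C-not-isolated 6→7 _ ()
  window-C-not-isolated 7→8 _ ()
  window-C-not-isolated 8→0 _ ()

  window-C̄-dominates : ∀ {l₀ l₁ l₂} → Step l₀ l₁ → Step l₁ l₂ → C-label l₁ ≡ false →
                       res5678 l₀ ≡ true ⊎ res5678 l₂ ≡ true
  window-C̄-dominates 3→4 4→5 _ = inj₂ refl
  window-C̄-dominates 4→5 5→6 _ = inj₂ refl
  window-C̄-dominates 5→6 _   _ = inj₁ refl
  window-C̄-dominates 6→7 _   _ = inj₁ refl
  window-C̄-dominates 7→8 _   _ = inj₁ refl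
  window-C̄-dominates 8→0 _   _ = inj₁ refl
  window-C̄-dominates 1→2 _ ()
  window-C̄-dominates 2→3 _ ()
  window-C̄-dominates 0→1 _ ()
  window-C̄-dominates 0→9 _ ()
  window-C̄-dominates 9→9 _ ()
  window-C̄-dominates 9→1 _ ()

  window-C̄-distance-two : ∀ {l₀ l₁ l₂ l₃ l₄} → Step l₀ l₁ → Step l₁ l₂ → Step l₂ l₃ → Step l₃ l₄ →
                          res5678 l₂ ≡ true → res5678 l₀ ≡ true ⊎ res5678 l₄ ≡ true
  window-C̄-distance-two _   4→5 5→6 6→7 _ = inj₂ refl
  window-C̄-distance-two _   5→6 6→7 7→8 _ = inj₂ refl
  window-C̄-distance-two 5→6 6→7 _   _   _ = inj₁ refl
  window-C̄-distance-two 6→7 7→8 _   _   _ = inj₁ refl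
  window-C̄-distance-two _ 1→2 _ _ ()
  window-C̄-distance-two _ 2→3 _ _ ()
  window-C̄-distance-two _ 3→4 _ _ ()
  window-C̄-distance-two _ 8→0 _ _ ()
  window-C̄-distance-two _ 0→1 _ _ ()
  window-C̄-distance-two _ 0→9 _ _ ()
  window-C̄-distance-two _ 9→9 _ _ ()
  window-C̄-distance-two _ 9→1 _ _ ()

  window-separates-edge : ∀ {l₀ l₁ l₂ l₃} → Step l₀ l₁ → Step l₁ l₂ → Step l₂ l₃ →
                          C-label l₀ ≡ true ⊎ C-label l₃ ≡ true ⊎ res5678 l₁ ≡ true ⊎ res5678 l₂ ≡ true
  window-separates-edge _   1→2 2→3 = inj₂ (inj₁ refl)
  window-separates-edge 1→2 2→3 _   = inj₁ refl
  window-separates-edge 2→3 3→4 _   = inj₁ refl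
  window-separates-edge _   4→5 _   = inj₂ (inj₂ (inj₂ refl))
  window-separates-edge _   5→6 _   = inj₂ (inj₂ (inj₁ refl))
  window-separates-edge _   6→7 _   = inj₂ (inj₂ (inj₁ refl))
  window-separates-edge _   7→8 _   = inj₂ (inj₂ (inj₁ refl))
  window-separates-edge _   8→0 _   = inj₂ (inj₂ (inj₁ refl))
  window-separates-edge _   0→1 1→2 = inj₂ (inj₁ refl)
  window-separates-edge _   0→9 9→9 = inj₂ (inj₁ refl)
  window-separates-edge _   0→9 9→1 = inj₂ (inj₁ refl)
  window-separates-edge _   9→9 9→9 = inj₂ (inj₁ refl)
  window-separates-edge _   9→9 9→1 = inj₂ (inj₁ refl)
  window-separates-edge _   9→1 1→2 = inj₂ (inj₁ refl)

  -- By definition, codeC N = tabulate (C-bit ∘ toℕ) and codeC̄ N = tabulate (C̄-bit ∘ toℕ).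
  C-bit : ℕ → Bool
  C-bit x = (res123 (suc x % 9) ∧ (suc x ≤ᵇ K)) ∨ (suc K ≤ᵇ suc x)

  C̄-bit : ℕ → Bool
  C̄-bit x = res5678 (suc x % 9) ∧ (suc x ≤ᵇ K)

  C-bit≡C-label : ∀ x → C-bit x ≡ C-label (lab x)
  C-bit≡C-label x with K ≤? x
  ... | yes K≤x = trans (cong ((res123 (suc x % 9) ∧ (suc x ≤ᵇ K)) ∨_) (T⇒≡true (≤⇒≤ᵇ (s≤s K≤x))))
                        (trans (∨-zeroʳ _) (sym (cong C-label (lab-≥ K≤x))))
  ... | no K≰x = begin
    (res123 t ∧ (suc x ≤ᵇ K)) ∨ (suc K ≤ᵇ suc x) ≡⟨ cong₂ (λ p q → (res123 t ∧ p) ∨ q) (T⇒≡true (≤⇒≤ᵇ x<K)) K⁺≰x⁺ ⟩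
    (res123 t ∧ true) ∨ false                  ≡⟨ trans (∨-identityʳ _) (∧-identityʳ _) ⟩
    res123 t                                   ≡⟨ ∨-identityʳ _ ⟨
    res123 t ∨ false                           ≡⟨ cong (res123 t ∨_) t≢9 ⟨
    C-label t                                  ≡⟨ cong C-label (lab-< x<K) ⟨
    C-label (lab x)                            ∎
    where
    open ≡-Reasoning
    t : ℕ
    t = suc x % 9
    x<K : x < K
    x<K = ≰⇒> K≰x
    K⁺≰x⁺ : (suc K ≤ᵇ suc x) ≡ false
    K⁺≰x⁺ = ¬T⇒≡false (λ h → K≰x (≤-pred (≤ᵇ⇒≤ (suc K) (suc x) h)))
    t≢9 : (t ≡ᵇ 9) ≡ false
    t≢9 = ¬T⇒≡false (λ h → <⇒≢ (m%n<n (suc x) 9) (≡ᵇ⇒≡ t 9 h))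

  C̄-bit≡res5678 : ∀ x → C̄-bit x ≡ res5678 (lab x)
  C̄-bit≡res5678 x with K ≤? x
  ... | yes K≤x = trans (cong (res5678 (suc x % 9) ∧_) (¬T⇒≡false (λ h → <⇒≱ (≤ᵇ⇒≤ (suc x) K h) K≤x)))
                        (trans (∧-zeroʳ _) (sym (cong res5678 (lab-≥ K≤x))))
  ... | no K≰x = trans (cong (res5678 (suc x % 9) ∧_) (T⇒≡true (≤⇒≤ᵇ (≰⇒> K≰x))))
                       (trans (∧-identityʳ _) (sym (cong res5678 (lab-< (≰⇒> K≰x)))))

  ∈C⁺ : ∀ {a} → C-label (label a) ≡ true → a ∈ codeC N
  ∈C⁺ {a} h = ∈-tabulate⁺ (C-bit ∘ toℕ) (trans (C-bit≡C-label (toℕ a)) h)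

  ∈C⁻ : ∀ {a} → a ∈ codeC N → C-label (label a) ≡ true
  ∈C⁻ {a} a∈C = trans (sym (C-bit≡C-label (toℕ a))) (∈-tabulate⁻ (C-bit ∘ toℕ) a∈C)

  ∉C⁻ : ∀ {a} → a ∉ codeC N → C-label (label a) ≡ false
  ∉C⁻ a∉C = ¬-not (a∉C ∘ ∈C⁺)

  ∈C̄⁺ : ∀ {a} → res5678 (label a) ≡ true → a ∈ codeC̄ N
  ∈C̄⁺ {a} h = ∈-tabulate⁺ (C̄-bit ∘ toℕ) (trans (C̄-bit≡res5678 (toℕ a)) h)

  ∈C̄⁻ : ∀ {a} → a ∈ codeC̄ N → res5678 (label a) ≡ true
  ∈C̄⁻ {a} a∈C̄ = trans (sym (C̄-bit≡res5678 (toℕ a))) (∈-tabulate⁻ (C̄-bit ∘ toℕ) a∈C̄)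

  ∉C̄⁻ : ∀ {a} → a ∉ codeC̄ N → res5678 (label a) ≡ false
  ∉C̄⁻ a∉C̄ = ¬-not (a∉C̄ ∘ ∈C̄⁺)

  -- The paper's v̄₅, …, v̄₈ (0-based indices 4, …, 7).
  witness<N : ∀ (i : Fin 4) → 4 + toℕ i < N
  witness<N i = <-≤-trans (+-monoʳ-< 4 (toℕ<n i)) (≤-trans 8≤m (n≤1+n m))

  witness : Fin 4 → Fin N
  witness i = fromℕ< (witness<N i)

  witness-injective : Injective _≡_ _≡_ witness
  witness-injective {i} {j} e =
    toℕ-injective (+-cancelˡ-≡ 4 _ _ (trans (sym (toℕ-fromℕ< (witness<N i))) (trans (cong toℕ e) (toℕ-fromℕ< (witness<N j)))))

  witness-∈ : ∀ i → witness i ∈ codeC̄ N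
  witness-∈ i = ∈C̄⁺ (trans (cong res5678 (trans (cong lab (toℕ-fromℕ< (witness<N i))) (lab-< in-period))) (in-5678 i))
    where
    in-period : 4 + toℕ i < K
    in-period = <-≤-trans (+-monoʳ-< 4 (toℕ<n i)) (≤-trans (n≤1+n 8) 9≤K)
    in-5678 : ∀ (i : Fin 4) → res5678 (suc (4 + toℕ i) % 9) ≡ true
    in-5678 zero                   = refl
    in-5678 (suc zero)             = refl
    in-5678 (suc (suc zero))       = refl
    in-5678 (suc (suc (suc zero))) = refl

  conditions : CodeConditions (codeC N) (codeC̄ N)
  conditions = record
    { C-dominates         = λ c c¹∉C c¹∉C̄ → Sum.map ∈C⁺ ∈C⁺
        (window-C-dominates (label-step c) (label-step (next c)) (∉C⁻ c¹∉C) (∉C̄⁻ c¹∉C̄))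
    ; C-not-isolated      = λ c c¹∈C → Sum.map ∈C⁺ ∈C⁺
        (window-C-not-isolated (label-step c) (label-step (next c)) (∈C⁻ c¹∈C))
    ; C̄-dominates         = λ c c¹∉C → Sum.map ∈C̄⁺ ∈C̄⁺
        (window-C̄-dominates (label-step c) (label-step (next c)) (∉C⁻ c¹∉C))
    ; C̄-distance-two      = λ c c²∈C̄ → Sum.map ∈C̄⁺ ∈C̄⁺
        (window-C̄-distance-two (label-step c) (label-step (next c)) (label-step (next^ 2 c)) (label-step (next^ 3 c))
                               (∈C̄⁻ c²∈C̄))
    ; separates-edges     = λ c → Sum.map ∈C⁺ (Sum.map ∈C⁺ (Sum.map ∈C̄⁺ ∈C̄⁺))
        (window-separates-edge (label-step c) (label-step (next c)) (label-step (next^ 2 c)))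
    ; C̄-witness           = witness
    ; C̄-witness-injective = witness-injective
    ; C̄-witness-∈         = witness-∈
    }

  code-identifying : IsIdentifyingCode (ComplementaryPrism (Cycle N)) (codeMember (codeC N , codeC̄ N))
  code-identifying = Criterion.identifying m (≤-trans (m≤m+n 4 4) 8≤m) conditions

  k r : ℕ
  k = N / 9
  r = N % 9

  N≡k*9+r : N ≡ k * 9 + r
  N≡k*9+r = trans (m≡m%n+[m/n]*n N 9) (+-comm r (k * 9))

  lab-periodic : ∀ q x → q < k → x < 9 → lab (q * 9 + x) ≡ suc x % 9
  lab-periodic q x q<k x<9 =
    trans (lab-< in-period) (trans (cong (λ t → suc t % 9) (+-comm (q * 9) x)) ([m+kn]%n≡m%n (suc x) q 9))
    where
    in-period : q * 9 + x < K
    in-period = begin-strict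
      q * 9 + x ≡⟨ +-comm (q * 9) x ⟩
      x + q * 9 <⟨ +-monoˡ-< (q * 9) x<9 ⟩
      suc q * 9 ≤⟨ *-monoˡ-≤ 9 q<k ⟩
      k * 9     ≡⟨ *-comm k 9 ⟩
      K         ∎
      where open ≤-Reasoning

  -- A full period contributes the residues 1, 2, 3 to C and 5, …, 8 to C̄, counted by evaluation.
  C-size : ∣ codeC N ∣ ≤ k * 3 + r
  C-size = begin
    ∣ codeC N ∣                                                  ≡⟨ ∣tabulate∣≡countBelow N C-bit ⟩
    countBelow C-bit N                                           ≡⟨ cong (countBelow C-bit) N≡k*9+r ⟩
    countBelow C-bit (k * 9 + r)                                 ≡⟨ countBelow-+ (k * 9) r C-bit ⟩
    countBelow C-bit (k * 9) + countBelow (λ x → C-bit (k * 9 + x)) r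
                                                                 ≤⟨ +-mono-≤ (countBelow-blocks 9 k C-bit 3 block) (countBelow-≤ r _) ⟩
    k * 3 + r                                                    ∎
    where
    open ≤-Reasoning
    block : ∀ q → q < k → countBelow (λ x → C-bit (q * 9 + x)) 9 ≤ 3
    block q q<k = ≤-reflexive (countBelow-cong 9 λ x x<9 →
      trans (C-bit≡C-label (q * 9 + x)) (cong C-label (lab-periodic q x q<k x<9)))

  C̄-size : ∣ codeC̄ N ∣ ≤ k * 4
  C̄-size = begin
    ∣ codeC̄ N ∣                                                  ≡⟨ ∣tabulate∣≡countBelow N C̄-bit ⟩
    countBelow C̄-bit N                                           ≡⟨ cong (countBelow C̄-bit) N≡k*9+r ⟩
    countBelow C̄-bit (k * 9 + r)                                 ≡⟨ countBelow-+ (k * 9) r C̄-bit ⟩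
    countBelow C̄-bit (k * 9) + countBelow (λ x → C̄-bit (k * 9 + x)) r
                                                                 ≡⟨ cong (countBelow C̄-bit (k * 9) +_) (countBelow-none r tail) ⟩
    countBelow C̄-bit (k * 9) + 0                                 ≡⟨ +-identityʳ _ ⟩
    countBelow C̄-bit (k * 9)                                     ≤⟨ countBelow-blocks 9 k C̄-bit 4 block ⟩
    k * 4                                                        ∎
    where
    open ≤-Reasoning
    block : ∀ q → q < k → countBelow (λ x → C̄-bit (q * 9 + x)) 9 ≤ 4
    block q q<k = ≤-reflexive (countBelow-cong 9 λ x x<9 →
      trans (C̄-bit≡res5678 (q * 9 + x)) (cong res5678 (lab-periodic q x q<k x<9)))
    tail : ∀ x → x < r → C̄-bit (k * 9 + x) ≡ false
    tail x _ = trans (C̄-bit≡res5678 (k * 9 + x)) (cong res5678 (lab-≥ (subst (_≤ k * 9 + x) (*-comm k 9) (m≤m+n (k * 9) x))))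

  size-bound : 9 * (∣ codeC N ∣ + ∣ codeC̄ N ∣) ≤ 7 * N + 16
  size-bound = begin
    9 * (∣ codeC N ∣ + ∣ codeC̄ N ∣) ≤⟨ *-monoʳ-≤ 9 (+-mono-≤ C-size C̄-size) ⟩
    9 * (k * 3 + r + k * 4)          ≡⟨ regroup k r ⟩
    7 * (k * 9 + r) + 2 * r          ≤⟨ +-monoʳ-≤ (7 * (k * 9 + r)) (*-monoʳ-≤ 2 (≤-pred (m%n<n N 9))) ⟩
    7 * (k * 9 + r) + 16             ≡⟨ cong (λ n → 7 * n + 16) N≡k*9+r ⟨
    7 * N + 16                       ∎
    where
    open ≤-Reasoning
    regroup : ∀ k r → 9 * (k * 3 + r + k * 4) ≡ 7 * (k * 9 + r) + 2 * r
    regroup = solve-∀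

lemma2 : (n : ℕ) → 9 ≤ n →
    IsIdentifyingCode (ComplementaryPrism (Cycle n)) (codeMember (codeC n , codeC̄ n))
    × (∃ λ (D : Subset n × Subset n) →
         IsIdentifyingCode (ComplementaryPrism (Cycle n)) (codeMember D)
         × 9 * (∣ proj₁ D ∣ + ∣ proj₂ D ∣) ≤ 7 * n + 16)
lemma2 (suc m) (s≤s 8≤m) = code-identifying , (codeC (suc m) , codeC̄ (suc m)) , code-identifying , size-bound
  where open PaperCode m 8≤m
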